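{- Let $n\ge 1$. Consider the following adversarial process. Set $R_0=S_n$. For $m=1,2,\dots$, the codebreaker submits an arbitrary query $x^m\in[n]^n$ (entries may repeat; $x^m$ may depend arbitrarily on the previous queries and answers); the codemaker answers with $b_m:=\min_{\sigma\in R_{m-1}}\mathrm{black}(\sigma,x^m)$, chooses some $y^m\in R_{m-1}$ with $\mathrm{black}(y^m,x^m)=b_m$, and sets $R_m:=\{\sigma\in S_n:\ \mathrm{black}(\sigma,x^j)=\mathrm{black}(y^j,x^j)\text{ for all } j\in[m]\}$. Then $b_m\le m$ for all $m\in\mathbb{N}$.
   Context: Permutations $\sigma\in S_n$ are identified with vectors $(\sigma(1),\dots,\sigma(n))\in[n]^n$ with pairwise distinct entries, where $[n]=\{1,\dots,n\}$. For $x,y\in[n]^n$, $\mathrm{black}(x,y)=|\{i\in[n]: x(i)=y(i)\}|$. Note $y^m\in R_m$, so each $R_m$ is nonempty and the process is well defined. -}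

module Defs where

open import Data.Nat using (ℕ; _≤_; pred)
open import Data.Product using (_×_)
open import Data.Fin using (Fin)
open import Data.Fin.Properties using (_≟_)
open import Data.Fin.Permutation using (Permutation′; _⟨$⟩ʳ_)
open import Data.List using (length; filter; allFin)
open import Relation.Binary.PropositionalEquality using (_≡_)

-- [n]^n, with [n] represented (0-indexed) as Fin n.
Word : ℕ → Set
Word n = Fin n → Fin n

Perm : ℕ → Set
Perm n = Permutation′ n

asWord : ∀ {n} → Perm n → Word n
asWord σ i = σ ⟨$⟩ʳ i

black : ∀ {n} → Word n → Word n → ℕ
black {n} x y = length (filter (λ i → x i ≟ y i) (allFin n))

-- σ ∈ R_m, given the query sequence x and codemaker choices y
-- (indices 1..m are used; index 0 is ignored).
InR : ∀ {n} → (ℕ → Word n) → (ℕ → Perm n) → ℕ → Perm n → Set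
InR x y m σ = ∀ j → 1 ≤ j → j ≤ m →
  black (asWord σ) (x j) ≡ black (asWord (y j)) (x j)

LegalPlay : ∀ {n} → (ℕ → Word n) → (ℕ → Perm n) → Set
LegalPlay x y = ∀ m → 1 ≤ m →
  InR x y (pred m) (y m) × (∀ σ → InR x y (pred m) σ →
     black (asWord (y m)) (x m) ≤ black (asWord σ) (x m))

-- Let σ = y^m and let K be the set of positions where σ agrees with x^m; suppose |K| > m.
-- Call a nonempty S ⊆ K a j-cluster of degree d if every v ∈ S has at least d partners
-- b ∈ S (b = v allowed) with σ(v) ≠ x^l(v) and σ(b) ≠ x^l(v) for all rounds l ≤ j; K is a
-- 0-cluster of degree |K|. In a j-cluster of degree d ≥ 2 with j < m, join v to those
-- partners b with also σ(b) ≠ x^{j+1}(v); as σ is injective, each v keeps at least d - 1.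
-- No cycle of such edges passes through a v with σ(v) = x^{j+1}(v): rotating σ along it
-- would keep the answers to x^1, …, x^j and make black(·, x^{j+1}) smaller than
-- black(y^{j+1}, x^{j+1}), against the codemaker's choice of y^{j+1}. Hence the positions
-- from which no such v can be reached form a (j+1)-cluster of degree d - 1. After m rounds
-- this yields an m-cluster of positive degree, whose members v have σ(v) ≠ x^m(v) although
-- they lie in K.

module Submission where

open import Data.Fin using (Fin; toℕ)
open import Data.Fin.Permutation
  using (Permutation′; permutation; _⟨$⟩ʳ_; _⟨$⟩ˡ_; _∘ₚ_; inverseˡ)
open import Data.Fin.Properties using (_≟_; any?; all?; ¬∀⟶∃¬; pigeonhole)
open import Data.List using (length; filter; allFin; _∷_)
open import Data.List.Membership.Propositional using (_∈_)
open import Data.List.Membership.Propositional.Properties using (∈-allFin)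
open import Data.List.Properties using (length-filter; length-tabulate)
open import Data.List.Relation.Unary.All as All using (All; []; _∷_)
open import Data.List.Relation.Unary.AllPairs using ([]; _∷_)
open import Data.List.Relation.Unary.Any using (here; there)
open import Data.List.Relation.Unary.Unique.Propositional using (Unique)
open import Data.List.Relation.Unary.Unique.Propositional.Properties using (allFin⁺)
open import Data.Nat
  using (ℕ; zero; suc; pred; _+_; _∸_; _≤_; _<_; _≤′_; ≤′-reflexive; ≤′-step; z≤n; s≤s; s≤s⁻¹; z<s)
open import Data.Nat.Properties
  using ( ≤-refl; ≤-trans; ≤-reflexive; ≤-antisym; <-irrefl; <-≤-trans; <⇒≤; ≮⇒≥
        ; m≤n⇒m≤1+n; m≤n⇒m<n∨m≡n; m<1+n⇒m<n∨m≡n; ≤⇒≤′; n<1+n; 1+n≰n; m+1+n≰m; pred-mono-≤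
        ; +-comm; +-suc; +-identityʳ; +-monoˡ-≤; m∸n+n≡m; m+n∸n≡m; ∸-monoˡ-≤
        ; pred[m∸n]≡m∸[1+n]; anyUpTo?)
open import Data.Product using (Σ; ∃; _×_; _,_; proj₁; proj₂)
open import Data.Sum using (_⊎_; inj₁; inj₂)
open import Data.Unit using (⊤; tt)
open import Function using (id; _∘_)
open import Relation.Binary.PropositionalEquality
  using (_≡_; _≢_; refl; sym; trans; cong; cong-app; subst; module ≡-Reasoning)
open import Relation.Nullary using (¬_; Dec; yes; no; contradiction)
open import Relation.Nullary.Decidable using (_×-dec_; _⊎-dec_; _→-dec_; ¬?; decidable-stable; toSum)
open import Relation.Unary using (Decidable; _⊆_)

open import Defs

m+n≤o⇒m≤o∸n : ∀ m n o → m + n ≤ o → m ≤ o ∸ n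
m+n≤o⇒m≤o∸n m n o h = subst (_≤ o ∸ n) (m+n∸n≡m m n) (∸-monoˡ-≤ n h)

module _ {A : Set} {P Q : A → Set} (P? : Decidable P) (Q? : Decidable Q) where

  length-filter-mono : ∀ {xs} → All (λ a → P a → Q a) xs →
                       length (filter P? xs) ≤ length (filter Q? xs)
  length-filter-mono [] = z≤n
  length-filter-mono {a ∷ _} (h ∷ hs) with P? a | Q? a
  ... | yes p | no ¬q = contradiction (h p) ¬q
  ... | yes _ | yes _ = s≤s (length-filter-mono hs)
  ... | no _  | yes _ = m≤n⇒m≤1+n (length-filter-mono hs)
  ... | no _  | no _  = length-filter-mono hs

  length-filter-mono-< : P ⊆ Q → ∀ {a xs} → a ∈ xs → Q a → ¬ P a →
                         length (filter P? xs) < length (filter Q? xs)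
  length-filter-mono-< P⊆Q {xs = b ∷ xs} (here refl) qb ¬pb with P? b | Q? b
  ... | yes pb | _      = contradiction pb ¬pb
  ... | no _   | no ¬qb = contradiction qb ¬qb
  ... | no _   | yes _  = s≤s (length-filter-mono {xs} (All.tabulate λ _ → P⊆Q))
  length-filter-mono-< P⊆Q {xs = b ∷ _} (there a∈xs) qa ¬pa with P? b | Q? b
  ... | yes pb | no ¬qb = contradiction (P⊆Q pb) ¬qb
  ... | yes _  | yes _  = s≤s (length-filter-mono-< P⊆Q a∈xs qa ¬pa)
  ... | no _   | yes _  = m≤n⇒m≤1+n (length-filter-mono-< P⊆Q a∈xs qa ¬pa)
  ... | no _   | no _   = length-filter-mono-< P⊆Q a∈xs qa ¬pa

module _ {A : Set} {P Q : A → Set} (P? : Decidable P) (Q? : Decidable Q) where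

  length-filter-≤-suc : ∀ {c xs} → (∀ {a} → Q a → P a ⊎ a ≡ c) → Unique xs →
                        length (filter Q? xs) ≤ suc (length (filter P? xs))
  length-filter-≤-suc _ [] = z≤n
  length-filter-≤-suc {xs = a ∷ _} Q⊆P∪c (a∉xs ∷ u) with P? a | Q? a
  ... | yes _  | yes _ = s≤s (length-filter-≤-suc Q⊆P∪c u)
  ... | yes _  | no _  = m≤n⇒m≤1+n (length-filter-≤-suc Q⊆P∪c u)
  ... | no _   | no _  = length-filter-≤-suc Q⊆P∪c u
  ... | no ¬pa | yes qa with Q⊆P∪c qa
  ...   | inj₁ pa   = contradiction pa ¬pa
  ...   | inj₂ refl = s≤s (length-filter-mono Q? P? (All.map Q⇒P a∉xs))
    where
    Q⇒P : ∀ {b} → a ≢ b → Q b → P b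
    Q⇒P a≢b qb with Q⊆P∪c qb
    ... | inj₁ pb   = pb
    ... | inj₂ refl = contradiction refl a≢b

count : ∀ {n} {P : Fin n → Set} → Decidable P → ℕ
count {n} P? = length (filter P? (allFin n))

module _ {n : ℕ} {P : Fin n → Set} (P? : Decidable P) where

  count≤n : count P? ≤ n
  count≤n = subst (count P? ≤_) (length-tabulate id) (length-filter P? (allFin n))

  count-witness : 0 < count P? → ∃ P
  count-witness = witness (allFin n)
    where
    witness : ∀ xs → 0 < length (filter P? xs) → ∃ P
    witness (a ∷ xs) h with P? a
    ... | yes pa = a , pa
    ... | no _   = witness xs h

module _ {n : ℕ} {P Q : Fin n → Set} (P? : Decidable P) (Q? : Decidable Q) where

  count-mono : P ⊆ Q → count P? ≤ count Q?
  count-mono P⊆Q = length-filter-mono P? Q? {allFin n} (All.tabulate λ _ → P⊆Q)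

  count-mono-< : ∀ {a} → P ⊆ Q → Q a → ¬ P a → count P? < count Q?
  count-mono-< P⊆Q = length-filter-mono-< P? Q? P⊆Q (∈-allFin _)

  count-≤-suc : ∀ {c} → (∀ {a} → Q a → P a ⊎ a ≡ c) → count Q? ≤ suc (count P?)
  count-≤-suc Q⊆P∪c = length-filter-≤-suc P? Q? Q⊆P∪c (allFin⁺ n)

module _ {n : ℕ} {u w z : Word n} where

  black-cong : (∀ i → u i ≡ w i ⊎ (u i ≢ z i × w i ≢ z i)) → black u z ≡ black w z
  black-cong h = ≤-antisym (count-mono (λ i → u i ≟ z i) (λ i → w i ≟ z i) u⇒w)
                           (count-mono (λ i → w i ≟ z i) (λ i → u i ≟ z i) w⇒u)
    where
    u⇒w : ∀ {i} → u i ≡ z i → w i ≡ z i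
    u⇒w {i} e with h i
    ... | inj₁ u≡w        = trans (sym u≡w) e
    ... | inj₂ (u≢z , _)  = contradiction e u≢z
    w⇒u : ∀ {i} → w i ≡ z i → u i ≡ z i
    w⇒u {i} e with h i
    ... | inj₁ u≡w        = trans u≡w e
    ... | inj₂ (_ , w≢z)  = contradiction e w≢z

  black-< : ∀ {a} → (∀ i → u i ≡ w i ⊎ u i ≢ z i) → w a ≡ z a → u a ≢ z a →
            black u z < black w z
  black-< h = count-mono-< (λ i → u i ≟ z i) (λ i → w i ≟ z i) u⇒w
    where
    u⇒w : ∀ {i} → u i ≡ z i → w i ≡ z i
    u⇒w {i} e with h i
    ... | inj₁ u≡w = trans (sym u≡w) e
    ... | inj₂ u≢z = contradiction e u≢z

module _ {R : ℕ → Set} (R-step : ∀ {r} → R r → R (suc r)) where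

  chain-mono : ∀ {r r′} → r ≤ r′ → R r → R r′
  chain-mono = go ∘ ≤⇒≤′
    where
    go : ∀ {r r′} → r ≤′ r′ → R r → R r′
    go (≤′-reflexive refl) = id
    go (≤′-step r≤′r′)     = R-step ∘ go r≤′r′

module _ {R : ℕ → Set} (R? : ∀ r → Dec (R r)) (R-step : ∀ {r} → R r → R (suc r)) where

  minimal : ∀ {r} → R r → ∃ λ r₀ → R r₀ × (∀ {r₁} → r₁ < r₀ → ¬ R r₁)
  minimal {zero}  h = 0 , h , λ ()
  minimal {suc r} h with R? r
  ... | yes h′ = minimal h′
  ... | no ¬h′ = suc r , h , λ r₁<1+r h₁ → ¬h′ (chain-mono R-step (s≤s⁻¹ r₁<1+r) h₁)

module _ {n : ℕ} {R : ℕ → Fin n → Set} (R? : ∀ r → Decidable (R r))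
         (R-step : ∀ {r} → R r ⊆ R (suc r)) where

  stabilises-or-grows : ∀ r → (∃ λ r → R (suc r) ⊆ R r) ⊎ r ≤ count (R? r)
  stabilises-or-grows zero = inj₂ z≤n
  stabilises-or-grows (suc r) with stabilises-or-grows r | all? (λ v → R? (suc r) v →-dec R? r v)
  ... | inj₁ stable  | _          = inj₁ stable
  ... | inj₂ _       | yes stable = inj₁ (r , λ {v} → stable v)
  ... | inj₂ r≤count | no ¬stable =
    let v , ¬[new⇒old] = ¬∀⟶∃¬ n _ (λ v → R? (suc r) v →-dec R? r v) ¬stable
        new  = decidable-stable (R? (suc r) v) λ ¬new → ¬[new⇒old] λ new → contradiction new ¬new
        ¬old = λ old → ¬[new⇒old] λ _ → old
    in inj₂ (<-≤-trans (s≤s r≤count) (count-mono-< (R? r) (R? (suc r)) R-step new ¬old))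

  chain-stabilises : ∃ λ r → R (suc r) ⊆ R r
  chain-stabilises with stabilises-or-grows (suc n)
  ... | inj₁ stable     = stable
  ... | inj₂ 1+n≤count = contradiction (≤-trans 1+n≤count (count≤n (R? (suc n)))) 1+n≰n

module _ {n : ℕ} where
  open import Function.Endo.Propositional (Fin n) using (_^_; ^-homo)

  ^-+ : ∀ (g : Fin n → Fin n) a b p → (g ^ (a + b)) p ≡ (g ^ a) ((g ^ b) p)
  ^-+ g a b = cong-app (^-homo g a b)

  ^-suc′ : ∀ (g : Fin n → Fin n) a p → (g ^ a) (g p) ≡ (g ^ suc a) p
  ^-suc′ g a p = trans (sym (^-+ g a 1 p)) (cong (λ t → (g ^ t) p) (+-comm a 1))

  record Cycle (next : Fin n → Fin n) : Set where
    field
      start  : Fin n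
      len    : ℕ
      closes : (next ^ suc len) start ≡ start

    OnCycle : Fin n → Set
    OnCycle p = ∃ λ s → s < suc len × (next ^ s) start ≡ p

    onCycle? : Decidable OnCycle
    onCycle? p = anyUpTo? (λ s → (next ^ s) start ≟ p) (suc len)

    next-onCycle : ∀ {p} → OnCycle p → OnCycle (next p)
    next-onCycle (s , s<1+len , refl) with m<1+n⇒m<n∨m≡n s<1+len
    ... | inj₁ s<len = suc s , s≤s s<len , refl
    ... | inj₂ refl  = 0 , z<s , sym closes

    ^-onCycle : ∀ t {p} → OnCycle p → OnCycle ((next ^ t) p)
    ^-onCycle zero    = id
    ^-onCycle (suc t) = next-onCycle ∘ ^-onCycle t

    periodic : ∀ {p} → OnCycle p → (next ^ suc len) p ≡ p
    periodic (s , _ , refl) = begin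
      (next ^ suc len) ((next ^ s) start)  ≡⟨ sym (^-+ next (suc len) s start) ⟩
      (next ^ (suc len + s)) start         ≡⟨ cong (λ t → (next ^ t) start) (+-comm (suc len) s) ⟩
      (next ^ (s + suc len)) start         ≡⟨ ^-+ next s (suc len) start ⟩
      (next ^ s) ((next ^ suc len) start)  ≡⟨ cong (next ^ s) closes ⟩
      (next ^ s) start                     ∎
      where open ≡-Reasoning

    no-descent : (μ : Fin n → ℕ) → ¬ (∀ {p} → OnCycle p → μ (next p) < μ p)
    no-descent μ descends =
      m+1+n≰m (μ start) (subst (λ p → μ p + suc len ≤ μ start) closes (drop (suc len) ≤-refl))
      where
      drop : ∀ s → s ≤ suc len → μ ((next ^ s) start) + s ≤ μ start
      drop zero    _       = ≤-reflexive (+-identityʳ _)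
      drop (suc s) s<1+len = begin
        μ ((next ^ suc s) start) + suc s  ≡⟨ +-suc _ s ⟩
        suc (μ ((next ^ suc s) start) + s) ≤⟨ +-monoˡ-≤ s (descends (s , s<1+len , refl)) ⟩
        μ ((next ^ s) start) + s          ≤⟨ drop s (<⇒≤ s<1+len) ⟩
        μ start                           ∎
        where open Data.Nat.Properties.≤-Reasoning hiding (start)

    cycle-meets : ∀ {A : Fin n → Set} → Decidable A → (μ : Fin n → ℕ) →
                  (∀ {p} → OnCycle p → ¬ A p → μ (next p) < μ p) →
                  ∃ λ p → OnCycle p × A p
    cycle-meets A? μ descends with any? (λ p → onCycle? p ×-dec A? p)
    ... | yes meets = meets
    ... | no misses = contradiction (λ {p} on → descends on λ a → misses (p , on , a)) (no-descent μ)

    rotateʳ : Fin n → Fin n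
    rotateʳ p with onCycle? p
    ... | yes _ = next p
    ... | no  _ = p

    rotateˡ : Fin n → Fin n
    rotateˡ p with onCycle? p
    ... | yes _ = (next ^ len) p
    ... | no  _ = p

    rotateʳ-on : ∀ {p} → OnCycle p → rotateʳ p ≡ next p
    rotateʳ-on {p} on with onCycle? p
    ... | yes _ = refl
    ... | no off = contradiction on off

    rotateʳ-off : ∀ {p} → ¬ OnCycle p → rotateʳ p ≡ p
    rotateʳ-off {p} off with onCycle? p
    ... | yes on = contradiction on off
    ... | no _   = refl

    rotateˡ-on : ∀ {p} → OnCycle p → rotateˡ p ≡ (next ^ len) p
    rotateˡ-on {p} on with onCycle? p
    ... | yes _ = refl
    ... | no off = contradiction on off

    rotateˡ-off : ∀ {p} → ¬ OnCycle p → rotateˡ p ≡ p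
    rotateˡ-off {p} off with onCycle? p
    ... | yes on = contradiction on off
    ... | no _   = refl

    rotateʳ-rotateˡ : ∀ p → rotateʳ (rotateˡ p) ≡ p
    rotateʳ-rotateˡ p with onCycle? p
    ... | yes on = trans (rotateʳ-on (^-onCycle len on)) (periodic on)
    ... | no off = rotateʳ-off off

    rotateˡ-rotateʳ : ∀ p → rotateˡ (rotateʳ p) ≡ p
    rotateˡ-rotateʳ p with onCycle? p
    ... | yes on = trans (rotateˡ-on (next-onCycle on)) (trans (^-suc′ next len p) (periodic on))
    ... | no off = rotateˡ-off off

    rotation : Permutation′ n
    rotation = permutation rotateʳ rotateˡ rotateʳ-rotateˡ rotateˡ-rotateʳ

  open Cycle using (OnCycle) public

  orbit-cycle : (g : Fin n → Fin n) (p : Fin n) →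
                Σ (Cycle g) λ c → ∀ {v} → OnCycle c v → ∃ λ s → (g ^ s) p ≡ v
  orbit-cycle g p with pigeonhole (n<1+n n) (λ i → (g ^ toℕ i) p)
  ... | i , j , i<j , gⁱp≡gʲp =
    record { start = (g ^ a) p ; len = L ; closes = closes } ,
    λ { (s , _ , refl) → s + a , ^-+ g s a p }
    where
    open ≡-Reasoning
    a L : ℕ
    a = toℕ i
    L = toℕ j ∸ suc a
    closes : (g ^ suc L) ((g ^ a) p) ≡ (g ^ a) p
    closes = begin
      (g ^ suc L) ((g ^ a) p)  ≡⟨ sym (^-+ g (suc L) a p) ⟩
      (g ^ (suc L + a)) p      ≡⟨ cong (λ t → (g ^ t) p) (trans (sym (+-suc L a)) (m∸n+n≡m i<j)) ⟩
      (g ^ toℕ j) p            ≡⟨ sym gⁱp≡gʲp ⟩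
      (g ^ a) p                ∎

  record Trap (E : Fin n → Fin n → Set) : Set₁ where
    field
      Member   : Fin n → Set
      member?  : Decidable Member
      nonempty : ∃ Member
      closed   : ∀ {v b} → Member v → E v b → Member b

  -- The trap is the set of vertices of S from which A cannot be reached. Were it empty,
  -- always moving one step closer to A would trace out a cycle through A.
  module _ {S A : Fin n → Set} {E : Fin n → Fin n → Set}
           (S? : Decidable S) (A? : Decidable A) (E? : ∀ v → Decidable (E v))
           (E⇒S : ∀ {v b} → E v b → S b) (E-total : ∀ {v} → S v → ∃ (E v))
           (cycles-miss-A : ∀ {g} (c : Cycle g) → (∀ {v} → OnCycle c v → E v (g v)) →
                            ∀ {v} → OnCycle c v → ¬ A v)
         where

    private
      Reaches : ℕ → Fin n → Set
      Reaches zero    v = A v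
      Reaches (suc r) v = Reaches r v ⊎ ∃ λ b → E v b × Reaches r b

      reaches? : ∀ r → Decidable (Reaches r)
      reaches? zero      = A?
      reaches? (suc r) v = reaches? r v ⊎-dec any? (λ b → E? v b ×-dec reaches? r b)

      r* : ℕ
      r* = proj₁ (chain-stabilises reaches? inj₁)

      module _ (S⊆Reaches : ∀ {v} → S v → Reaches r* v) where

        level : Fin n → ℕ
        level v with S? v
        ... | yes sv = proj₁ (minimal (λ r → reaches? r v) inj₁ {r*} (S⊆Reaches {v} sv))
        ... | no _   = 0

        level-minimal : ∀ {v} → S v → Reaches (level v) v × (∀ {r} → r < level v → ¬ Reaches r v)
        level-minimal {v} sv with S? v
        ... | yes sv′ = proj₂ (minimal (λ r → reaches? r v) inj₁ {r*} (S⊆Reaches {v} sv′))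
        ... | no ¬sv  = contradiction sv ¬sv

        descend : ∀ {v} → S v → ¬ A v → ∃ λ b → E v b × level b < level v
        descend {v} sv ¬av = go (level v) (level-minimal sv)
          where
          go : ∀ l → Reaches l v × (∀ {r} → r < l → ¬ Reaches r v) → ∃ λ b → E v b × level b < l
          go zero    (av , _)                 = contradiction av ¬av
          go (suc l) (inj₁ rv , below)        = contradiction rv (below (n<1+n l))
          go (suc l) (inj₂ (b , e , rb) , _) =
            b , e , s≤s (≮⇒≥ λ l<level → proj₂ (level-minimal (E⇒S e)) l<level rb)

        toward-A : Fin n → Fin n
        toward-A v with toSum (S? v) | toSum (A? v)
        ... | inj₁ sv | inj₁ _   = proj₁ (E-total sv)
        ... | inj₁ sv | inj₂ ¬av = proj₁ (descend sv ¬av)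
        ... | inj₂ _  | _        = v

        toward-A-spec : ∀ {v} → S v → E v (toward-A v) × (¬ A v → level (toward-A v) < level v)
        toward-A-spec {v} sv with toSum (S? v) | toSum (A? v)
        ... | inj₁ sv′ | inj₁ av  = proj₂ (E-total {v} sv′) , λ ¬av → contradiction av ¬av
        ... | inj₁ sv′ | inj₂ ¬av = let _ , e , down = descend {v} sv′ ¬av in e , λ _ → down
        ... | inj₂ ¬sv | _        = contradiction sv ¬sv

        S-empty : ¬ ∃ S
        S-empty (p , sp) =
          let v , on , av = Cycle.cycle-meets c A? level (λ on → proj₂ (toward-A-spec (on⇒S on)))
          in cycles-miss-A c (λ on → proj₁ (toward-A-spec (on⇒S on))) on av
          where
          c : Cycle toward-A
          c = proj₁ (orbit-cycle toward-A p)
          ^-S : ∀ s → S ((toward-A ^ s) p)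
          ^-S zero    = sp
          ^-S (suc s) = E⇒S (proj₁ (toward-A-spec (^-S s)))
          on⇒S : ∀ {v} → OnCycle c v → S v
          on⇒S on = let s , gˢp≡v = proj₂ (orbit-cycle toward-A p) on in subst S gˢp≡v (^-S s)

    avoiding-trap : ∃ S → Σ (Trap E) λ T → ∀ {v} → Trap.Member T v → S v × ¬ A v
    avoiding-trap ∃S with any? (λ v → S? v ×-dec ¬? (reaches? r* v))
    ... | yes nonempty =
      trap , λ {v} (sv , ¬rv) → sv , ¬rv ∘ chain-mono {λ r → Reaches r v} inj₁ {r′ = r*} z≤n
      where
      trap : Trap E
      trap = record
        { Member   = λ v → S v × ¬ Reaches r* v
        ; member?  = λ v → S? v ×-dec ¬? (reaches? r* v)
        ; nonempty = nonempty
        ; closed   = λ (_ , ¬rv) e → E⇒S e , λ rb →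
                       ¬rv (proj₂ (chain-stabilises reaches? inj₁) (inj₂ (_ , e , rb)))
        }
    ... | no empty = contradiction ∃S (S-empty S⊆Reaches)
      where
      S⊆Reaches : ∀ {v} → S v → Reaches r* v
      S⊆Reaches {v} sv = decidable-stable (reaches? r* v) λ ¬rv → empty (v , sv , ¬rv)

module Game {n : ℕ} (x : ℕ → Word n) (y : ℕ → Perm n) (legal : LegalPlay x y) (m′ : ℕ) where

  σ : Perm n
  σ = y (suc m′)

  bₘ : ℕ
  bₘ = black (asWord σ) (x (suc m′))

  σ∈R : InR x y m′ σ
  σ∈R = proj₁ (legal (suc m′) (s≤s z≤n))

  -- Hit j and Movable j concern round j + 1, whereas Avoids j concerns rounds 1, …, j.
  Hit : ℕ → Fin n → Set
  Hit j v = asWord σ v ≡ x (suc j) v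

  hit? : ∀ j → Decidable (Hit j)
  hit? j v = asWord σ v ≟ x (suc j) v

  Avoids : ℕ → Fin n → Fin n → Set
  Avoids zero    v b = ⊤
  Avoids (suc j) v b = Avoids j v b × asWord σ v ≢ x (suc j) v × asWord σ b ≢ x (suc j) v

  avoids? : ∀ j v → Decidable (Avoids j v)
  avoids? zero    v b = yes tt
  avoids? (suc j) v b = avoids? j v b ×-dec ¬? (hit? j v) ×-dec ¬? (asWord σ b ≟ x (suc j) v)

  avoids-round : ∀ {j v b} → Avoids j v b → ∀ {l} → 1 ≤ l → l ≤ j →
                 asWord σ v ≢ x l v × asWord σ b ≢ x l v
  avoids-round {zero} _ {suc _} _ ()
  avoids-round {suc j} (av , σv≢ , σb≢) {l} 1≤l l≤1+j with m≤n⇒m<n∨m≡n l≤1+j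
  ... | inj₁ l<1+j = avoids-round av 1≤l (s≤s⁻¹ l<1+j)
  ... | inj₂ refl  = σv≢ , σb≢

  Movable : ℕ → Fin n → Fin n → Set
  Movable j v b = Avoids j v b × asWord σ b ≢ x (suc j) v

  no-improving-cycle : ∀ {j} → j ≤ m′ → ∀ {g} (c : Cycle g) →
                       (∀ {v} → OnCycle c v → Movable j v (g v)) →
                       ∀ {v} → OnCycle c v → ¬ Hit j v
  no-improving-cycle {j} j≤m′ {g} c movable {a} on hit =
    <-irrefl refl (<-≤-trans worse (≤-trans (≤-reflexive σ-ties) y-minimal))
    where
    open Cycle c using (rotation; onCycle?; rotateʳ-on; rotateʳ-off)
    σ′ : Perm n
    σ′ = rotation ∘ₚ σ

    same-off-cycle : ∀ i → ¬ OnCycle c i → asWord σ′ i ≡ asWord σ i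
    same-off-cycle i off = cong (σ ⟨$⟩ʳ_) (rotateʳ-off off)

    moved-on-cycle : ∀ i → OnCycle c i → asWord σ′ i ≡ asWord σ (g i)
    moved-on-cycle i on = cong (σ ⟨$⟩ʳ_) (rotateʳ-on on)

    σ′∈R : InR x y j σ′
    σ′∈R l 1≤l l≤j = trans (black-cong agree) (σ∈R l 1≤l (≤-trans l≤j j≤m′))
      where
      agree : ∀ i → asWord σ′ i ≡ asWord σ i ⊎ (asWord σ′ i ≢ x l i × asWord σ i ≢ x l i)
      agree i with toSum (onCycle? i)
      ... | inj₂ off = inj₁ (same-off-cycle i off)
      ... | inj₁ on = let σi≢ , σgi≢ = avoids-round (proj₁ (movable on)) 1≤l l≤j in
                     inj₂ ((σgi≢ ∘ trans (sym (moved-on-cycle i on))) , σi≢)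

    worse : black (asWord σ′) (x (suc j)) < black (asWord σ) (x (suc j))
    worse = black-< agree hit (proj₂ (movable on) ∘ trans (sym (moved-on-cycle a on)))
      where
      agree : ∀ i → asWord σ′ i ≡ asWord σ i ⊎ asWord σ′ i ≢ x (suc j) i
      agree i with toSum (onCycle? i)
      ... | inj₂ off = inj₁ (same-off-cycle i off)
      ... | inj₁ on = inj₂ (proj₂ (movable on) ∘ trans (sym (moved-on-cycle i on)))

    σ-ties : black (asWord σ) (x (suc j)) ≡ black (asWord (y (suc j))) (x (suc j))
    σ-ties with m≤n⇒m<n∨m≡n j≤m′
    ... | inj₁ j<m′ = σ∈R (suc j) (s≤s z≤n) j<m′
    ... | inj₂ refl = refl

    y-minimal : black (asWord (y (suc j))) (x (suc j)) ≤ black (asWord σ′) (x (suc j))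
    y-minimal = proj₂ (legal (suc j) (s≤s z≤n)) σ′ σ′∈R

  record Cluster (j d : ℕ) : Set₁ where
    field
      Member   : Fin n → Set
      member?  : Decidable Member
      nonempty : ∃ Member
      hits     : ∀ {v} → Member v → Hit m′ v
      degree   : ∀ {v} → Member v → d ≤ count (λ b → member? b ×-dec avoids? j v b)

  cluster-zero : 0 < bₘ → Cluster 0 bₘ
  cluster-zero 0<bₘ = record
    { Member   = Hit m′
    ; member?  = hit? m′
    ; nonempty = count-witness (hit? m′) 0<bₘ
    ; hits     = id
    ; degree   = λ {v} _ → count-mono (hit? m′) (λ b → hit? m′ b ×-dec avoids? 0 v b) (_, tt)
    }

  cluster-suc : ∀ {j d} → j ≤ m′ → 2 ≤ d → Cluster j d → Cluster (suc j) (pred d)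
  cluster-suc {j} {d} j≤m′ 2≤d C = record
    { Member   = Trap.Member T
    ; member?  = Trap.member? T
    ; nonempty = Trap.nonempty T
    ; hits     = hits ∘ proj₁ ∘ T⊆C∖Hit
    ; degree   = λ tv → ≤-trans (out-degree (proj₁ (T⊆C∖Hit tv))) (edges⊆partners tv)
    }
    where
    open Cluster C

    Edge : Fin n → Fin n → Set
    Edge v b = Member b × Movable j v b

    edge? : ∀ v → Decidable (Edge v)
    edge? v b = member? b ×-dec avoids? j v b ×-dec ¬? (asWord σ b ≟ x (suc j) v)

    out-degree : ∀ {v} → Member v → pred d ≤ count (edge? v)
    out-degree {v} mv = pred-mono-≤ (≤-trans (degree mv) (count-≤-suc (edge? v) _ edge-or-hit))
      where
      edge-or-hit : ∀ {b} → Member b × Avoids j v b → Edge v b ⊎ b ≡ σ ⟨$⟩ˡ x (suc j) v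
      edge-or-hit {b} (mb , av) with asWord σ b ≟ x (suc j) v
      ... | yes σb≡ = inj₂ (trans (sym (inverseˡ σ)) (cong (σ ⟨$⟩ˡ_) σb≡))
      ... | no σb≢  = inj₁ (mb , av , σb≢)

    trap : Σ (Trap Edge) λ T → ∀ {v} → Trap.Member T v → Member v × ¬ Hit j v
    trap = avoiding-trap member? (hit? j) edge? proj₁
             (λ mv → count-witness (edge? _) (≤-trans (pred-mono-≤ 2≤d) (out-degree mv)))
             (λ c edges → no-improving-cycle j≤m′ c (proj₂ ∘ edges))
             nonempty

    T : Trap Edge
    T = proj₁ trap

    T⊆C∖Hit : ∀ {v} → Trap.Member T v → Member v × ¬ Hit j v
    T⊆C∖Hit = proj₂ trap

    edges⊆partners : ∀ {v} → Trap.Member T v →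
                     count (edge? v) ≤ count (λ b → Trap.member? T b ×-dec avoids? (suc j) v b)
    edges⊆partners {v} tv = count-mono (edge? v) _ λ e@(_ , av , σb≢) →
      Trap.closed T tv e , av , proj₂ (T⊆C∖Hit tv) , σb≢

  no-cluster-after-last-round : ∀ {d} → 1 ≤ d → ¬ Cluster (suc m′) d
  no-cluster-after-last-round 1≤d C =
    let v , mv = nonempty
        _ , _ , _ , σv≢ , _ = count-witness (λ b → member? b ×-dec avoids? (suc m′) v b)
                                            (≤-trans 1≤d (degree mv))
    in σv≢ (hits mv)
    where open Cluster C

  clusters : suc m′ < bₘ → ∀ j → j ≤ suc m′ → Cluster j (bₘ ∸ j)
  clusters m<bₘ zero    _     = cluster-zero (<-≤-trans z<s m<bₘ)
  clusters m<bₘ (suc j) 1+j≤m = subst (Cluster (suc j)) (pred[m∸n]≡m∸[1+n] bₘ j)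
    (cluster-suc (s≤s⁻¹ 1+j≤m) (m+n≤o⇒m≤o∸n 2 j bₘ (≤-trans (s≤s 1+j≤m) m<bₘ))
      (clusters m<bₘ j (m≤n⇒m≤1+n (s≤s⁻¹ 1+j≤m))))

  bₘ≤m : bₘ ≤ suc m′
  bₘ≤m = ≮⇒≥ λ m<bₘ → no-cluster-after-last-round (m+n≤o⇒m≤o∸n 1 (suc m′) bₘ m<bₘ)
                                                   (clusters m<bₘ (suc m′) ≤-refl)

lemma2 : (n : ℕ) → 1 ≤ n → (x : ℕ → Word n) → (y : ℕ → Perm n) →
    LegalPlay x y → (m : ℕ) → 1 ≤ m → black (asWord (y m)) (x m) ≤ m
lemma2 n _ x y legal (suc m′) _ = Game.bₘ≤m x y legal m′
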